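{- For every $\lambda$-term $t$ in de Bruijn notation, $\mathsf{readback}(\mathsf{read}(t))=t$.
   Context: De Bruijn terms: $t::=\underline{n}\mid\lambda t\mid t\,t$. An ®-index is a pair $(n,\alpha)$ with $n\in\mathbb{N}$ and $\alpha$ a finite string over $\{0,1\}$ ($\varepsilon$ the empty string; $\alpha b$ is $\alpha$ followed by the bit $b$). Terms with resources: $u::=(n,\alpha)\mid\lambda u\mid u\,u\mid (n,\alpha)\odot u\mid (n,\alpha)\triangledown u$. The translation $\mathsf{readback}$ from terms with resources to de Bruijn terms is: $\mathsf{readback}((n,\alpha))=\underline{n}$; $\mathsf{readback}(\lambda u)=\lambda\,\mathsf{readback}(u)$; $\mathsf{readback}(u_1u_2)=\mathsf{readback}(u_1)\,\mathsf{readback}(u_2)$; $\mathsf{readback}((n,\alpha)\odot u)=\mathsf{readback}((n,\alpha)\triangledown u)=\mathsf{readback}(u)$. The translation $\mathsf{read}$ is: $\mathsf{read}(\underline{n})=(n,\varepsilon)$; $\mathsf{read}(\lambda t)=\lambda u$ if the ®-index $(0,\varepsilon)$ occurs in $u=\mathsf{read}(t)$, and $\lambda((0,\varepsilon)\odot u)$ otherwise; $\mathsf{read}(t_1t_2)=c_1\triangledown(c_2\triangledown\cdots(c_k\triangledown(\rho_0(\mathsf{read}\,t_1)\;\rho_1(\mathsf{read}\,t_2)))\cdots)$, where $c_1,\dots,c_k$ are the ®-indices occurring both in $\mathsf{read}(t_1)$ and in $\mathsf{read}(t_2)$, and $\rho_b$ ($b\in\{0,1\}$) renames each occurrence of such an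 ®-index $(n,\alpha)$ into $(n,\alpha b)$. -}

module Defs where

open import Data.Nat using (ℕ)
open import Data.Bool using (Bool; true; false)
open import Data.List using (List; []; _∷_; _++_; [_]; filter; foldr; deduplicate)
open import Data.Product using (_×_; _,_)
open import Relation.Binary.PropositionalEquality using (_≡_)
open import Relation.Nullary using (Dec; yes; no)
import Data.Nat.Properties as ℕP
import Data.Bool.Properties as BP
import Data.List.Properties as LP
import Data.Product.Properties as PP
import Data.List.Membership.DecPropositional as DecMem

data Term : Set where
  var : ℕ → Term
  lam : Term → Term
  app : Term → Term → Term

-- Bit strings over {0,1}: false = 0, true = 1.  α b = α ++ [ b ].
BitString : Set
BitString = List Bool

RIndex : Set
RIndex = ℕ × BitString

_≟R_ : (x y : RIndex) → Dec (x ≡ y)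
_≟R_ = PP.≡-dec ℕP._≟_ (LP.≡-dec BP._≟_)

open DecMem _≟R_ using (_∈?_)

data RTerm : Set where
  ridx : RIndex → RTerm
  rlam : RTerm → RTerm
  rapp : RTerm → RTerm → RTerm
  _⊙_  : RIndex → RTerm → RTerm
  _▽_  : RIndex → RTerm → RTerm

readback : RTerm → Term
readback (ridx (n , α)) = var n
readback (rlam u) = lam (readback u)
readback (rapp u₁ u₂) = app (readback u₁) (readback u₂)
readback (c ⊙ u) = readback u
readback (c ▽ u) = readback u

occ : RTerm → List RIndex
occ (ridx c) = c ∷ []
occ (rlam u) = occ u
occ (rapp u₁ u₂) = occ u₁ ++ occ u₂
occ (c ⊙ u) = c ∷ occ u
occ (c ▽ u) = c ∷ occ u

occurring : RTerm → List RIndex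
occurring u = deduplicate _≟R_ (occ u)

common : RTerm → RTerm → List RIndex
common u₁ u₂ = filter (_∈? occurring u₂) (occurring u₁)

renameIdx : List RIndex → Bool → RIndex → RIndex
renameIdx cs b (n , α) with (n , α) ∈? cs
... | yes _ = (n , α ++ [ b ])
... | no  _ = (n , α)

ρ : List RIndex → Bool → RTerm → RTerm
ρ cs b (ridx c) = ridx (renameIdx cs b c)
ρ cs b (rlam u) = rlam (ρ cs b u)
ρ cs b (rapp u₁ u₂) = rapp (ρ cs b u₁) (ρ cs b u₂)
ρ cs b (c ⊙ u) = renameIdx cs b c ⊙ ρ cs b u
ρ cs b (c ▽ u) = renameIdx cs b c ▽ ρ cs b u

wrap▽ : List RIndex → RTerm → RTerm
wrap▽ cs u = foldr _▽_ u cs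

read : Term → RTerm
read (var n) = ridx (n , [])
read (lam t) with (0 , []) ∈? occurring (read t)
... | yes _ = rlam (read t)
... | no  _ = rlam ((0 , []) ⊙ read t)
read (app t₁ t₂) =
  let u₁ = read t₁
      u₂ = read t₂
      cs = common u₁ u₂
  in wrap▽ cs (rapp (ρ cs false u₁) (ρ cs true u₂))

-- read only adds ⊙/▽ annotations and renames the bit-string half of ®-indices,
-- while readback forgets the annotations and keeps only the ℕ half of each
-- index; so readback ∘ read is the identity.
module Submission where

open import Data.Bool using (false; true)
open import Data.List using (List; []; _∷_)
open import Data.Product using (_,_)
open import Relation.Binary.PropositionalEquality using (_≡_; refl; cong; cong₂; module ≡-Reasoning)
open import Relation.Nullary using (yes; no)

open import Defs
open import Data.List.Membership.DecPropositional _≟R_ using (_∈?_)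

readback-ridx-renameIdx : ∀ cs b c → readback (ridx (renameIdx cs b c)) ≡ readback (ridx c)
readback-ridx-renameIdx cs b (n , α) with (n , α) ∈? cs
... | yes _ = refl
... | no  _ = refl

readback-ρ : ∀ cs b u → readback (ρ cs b u) ≡ readback u
readback-ρ cs b (ridx c)     = readback-ridx-renameIdx cs b c
readback-ρ cs b (rlam u)     = cong lam (readback-ρ cs b u)
readback-ρ cs b (rapp u₁ u₂) = cong₂ app (readback-ρ cs b u₁) (readback-ρ cs b u₂)
readback-ρ cs b (c ⊙ u)      = readback-ρ cs b u
readback-ρ cs b (c ▽ u)      = readback-ρ cs b u

readback-wrap▽ : ∀ cs u → readback (wrap▽ cs u) ≡ readback u
readback-wrap▽ []       u = refl
readback-wrap▽ (c ∷ cs) u = readback-wrap▽ cs u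

proposition7 : (t : Term) → readback (read t) ≡ t
proposition7 (var n) = refl
proposition7 (lam t) with (0 , []) ∈? occurring (read t)
... | yes _ = cong lam (proposition7 t)
... | no  _ = cong lam (proposition7 t)
proposition7 (app t₁ t₂) = begin
  readback (wrap▽ cs (rapp (ρ cs false u₁) (ρ cs true u₂)))
    ≡⟨ readback-wrap▽ cs _ ⟩
  app (readback (ρ cs false u₁)) (readback (ρ cs true u₂))
    ≡⟨ cong₂ app (readback-ρ cs false u₁) (readback-ρ cs true u₂) ⟩
  app (readback u₁) (readback u₂)
    ≡⟨ cong₂ app (proposition7 t₁) (proposition7 t₂) ⟩
  app t₁ t₂ ∎
  where
  open ≡-Reasoning
  u₁ u₂ : RTerm
  u₁ = read t₁
  u₂ = read t₂
  cs : List RIndex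
  cs = common u₁ u₂
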